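{- For every integer $k\ge 2$, \[\textup{aw}(P_3\square C_{2k},3)=\begin{cases}3 & \text{if $k$ is even,}\\ 4 & \text{if $k$ is odd.}\end{cases}\]
   Context: All graphs are finite, simple and undirected; $\textup{d}(u,v)$ denotes shortest-path distance. $P_m$ is the path on $m$ vertices and $C_n$ the cycle on $n$ vertices. The Cartesian product $G\square H$ has vertex set $V(G)\times V(H)$, with $(x,y)$ adjacent to $(x',y')$ iff either $x=x'$ and $yy'\in E(H)$, or $y=y'$ and $xx'\in E(G)$. A 3-term arithmetic progression (3-AP) is a set of vertices $\{v_1,v_2,v_3\}$ (listed in some order) with $\textup{d}(v_1,v_2)=\textup{d}(v_2,v_3)$. An exact $r$-coloring of a graph $G$ is a surjective map $c:V(G)\to\{1,\dots,r\}$; a set is rainbow under $c$ if its vertices receive pairwise distinct colors. $\textup{aw}(G,3)$ is the least positive integer $r$ such that every exact $r$-coloring of $G$ contains a rainbow 3-AP; if no coloring yields a rainbow 3-AP, then $\textup{aw}(G,3)=|V(G)|+1$. -}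

module Defs where

open import Data.Nat using (ℕ; zero; suc; _+_; _*_; _≤_; _<_; _%_; NonZero)
open import Data.Fin using (Fin; toℕ)
open import Data.Fin.Properties using (*↔×)
open import Data.Product using (Σ; ∃; ∃-syntax; _×_; _,_)
open import Data.Sum using (_⊎_)
open import Function.Bundles using (_↔_)
open import Function.Properties.Inverse using (↔-refl; ↔-trans; ↔-sym)
open import Data.Product.Function.NonDependent.Propositional using (_×-↔_)
open import Relation.Binary.PropositionalEquality using (_≡_; _≢_)
open import Relation.Nullary using (¬_)

record Graph : Set₁ where
  field
    V     : Set
    Adj   : V → V → Set
    order : ℕ
    enum  : V ↔ Fin order
open Graph public

P : ℕ → Graph
P m = record
  { V = Fin m
  ; Adj = λ i j → (suc (toℕ i) ≡ toℕ j) ⊎ (suc (toℕ j) ≡ toℕ i)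
  ; order = m
  ; enum = ↔-refl
  }

-- Cycle C_n (n ≥ 3) on vertices 0,…,n-1; i ~ j iff j ≡ i+1 (mod n) or i ≡ j+1 (mod n),
-- written without mod: either j = i+1, or i = n-1 and j = 0 (and symmetrically).
CycAdj : (n : ℕ) → Fin n → Fin n → Set
CycAdj n i j = (suc (toℕ i) ≡ toℕ j) ⊎ (suc (toℕ i) ≡ n × toℕ j ≡ 0)

C : ℕ → Graph
C n = record
  { V = Fin n
  ; Adj = λ i j → CycAdj n i j ⊎ CycAdj n j i
  ; order = n
  ; enum = ↔-refl
  }

_□_ : Graph → Graph → Graph
G □ H = record
  { V = V G × V H
  ; Adj = λ { (x , y) (x' , y') → (x ≡ x' × Adj H y y') ⊎ (y ≡ y' × Adj G x x') }
  ; order = order G * order H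
  ; enum = ↔-trans (enum G ×-↔ enum H) (↔-sym (*↔× {order G} {order H}))
  }

data Walk (G : Graph) : V G → V G → ℕ → Set where
  here : ∀ {u} → Walk G u u zero
  step : ∀ {u v w ℓ} → Adj G u v → Walk G v w ℓ → Walk G u w (suc ℓ)

Dist : (G : Graph) → V G → V G → ℕ → Set
Dist G u v n = Walk G u v n × (∀ m → Walk G u v m → n ≤ m)

Exact : (G : Graph) (r : ℕ) → (V G → Fin r) → Set
Exact G r c = ∀ j → ∃[ v ] c v ≡ j

HasRainbow3AP : (G : Graph) {r : ℕ} → (V G → Fin r) → Set
HasRainbow3AP G c =
  ∃[ v₁ ] ∃[ v₂ ] ∃[ v₃ ] ∃[ d ]
    (Dist G v₁ v₂ d × Dist G v₂ v₃ d ×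
     c v₁ ≢ c v₂ × c v₂ ≢ c v₃ × c v₁ ≢ c v₃)

AllRainbow : Graph → ℕ → Set
AllRainbow G r = (c : V G → Fin r) → Exact G r c → HasRainbow3AP G c

IsAW3 : Graph → ℕ → Set
IsAW3 G m =
  (1 ≤ m × m ≤ order G × AllRainbow G m × (∀ r → 1 ≤ r → r < m → ¬ AllRainbow G r))
  ⊎ (m ≡ suc (order G) × (∀ r → 1 ≤ r → r ≤ order G → ¬ AllRainbow G r))

-- Distances in P₃ □ C₂ₖ are sums of a row distance and a cyclic distance, so 3-APs can be
-- written down explicitly.
--
-- Let c use at least three colours without a rainbow 3-AP. In the middle row,
-- a block β…β shorter than k squeezed between colours α and γ always yields a rainbow 3-AP
-- (through the top row), so every window of length at most k of the middle row is two-coloured,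
-- and then so is the whole middle row. If the middle row used two colours, a third colour on
-- the top row would force a bottom vertex into three incompatible colour pairs; hence the middle
-- row is monochromatic, say a, and (after swapping top and bottom) some top vertex x has a colour
-- R ≠ a. Every vertex other than the antipode x* of x is within distance k + 1 of x, and a 3-AP
-- through the middle row colours it R or a. So at most three colours occur, excluding exact
-- 4-colourings; and for even k the top vertex at distance k/2 + 1 from x is equidistant from x
-- and x*, is coloured a, and completes a rainbow 3-AP.
--
-- Colour x and x* with two colours and everything else with a third:
-- δ(x, w) + δ(w, x*) = k + 2 is odd, and x* is the only vertex at distance k + 2 from x, so no
-- 3-AP is rainbow.

module Submission where

open import Defs
open import Data.Nat using (ℕ; _*_; _≤_; _%_)
open import Data.Product using (_×_)
open import Relation.Binary.PropositionalEquality using (_≡_)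

open import Algebra.Properties.CommutativeSemigroup using (interchange)
open import Data.Empty using (⊥; ⊥-elim)
open import Data.Fin using (Fin; toℕ; fromℕ<; opposite; punchOut; _≟_) renaming (suc to fsuc)
open import Data.Fin.Patterns using (0F; 1F; 2F)
open import Data.Fin.Properties
  using (toℕ-fromℕ<; toℕ-injective; toℕ<n; any?; pigeonhole; opposite-involutive; punchOut-injective)
  renaming (<⇒≢ to <⇒≢ᶠ)
open import Data.Nat using (zero; suc; _+_; _∸_; _<_; _⊓_; ∣_-_∣; z≤n; s≤s; z<s; NonZero; >-nonZero⁻¹)
open import Data.Nat.DivMod
  using (_/_; m≡m%n+[m/n]*n; m%n<n; n%n≡0; m%n%n≡m%n; %-distribˡ-+; [m+n]%n≡m%n; m<n⇒m%n≡m)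
open import Data.Nat.Properties hiding (_≟_)
open import Data.Nat.Properties using () renaming (_≟_ to _≟ℕ_)
open import Data.Product using (∃; ∃-syntax; _,_; proj₁; proj₂)
open import Data.Product.Properties using (≡-dec)
open import Data.Sum using (_⊎_; inj₁; inj₂)
import Data.Sum as Sum
open import Function using (_∘_; id)
open import Function.Bundles using (Inverse)
open import Relation.Binary.PropositionalEquality
  using (_≢_; refl; sym; trans; cong; cong₂; subst; subst₂; module ≡-Reasoning)
open import Relation.Nullary using (¬_; Dec; yes; no)
open import Relation.Nullary.Decidable using (¬?; _×-dec_)

Distinct3 : {A : Set} → A → A → A → Set
Distinct3 a b c = a ≢ b × b ≢ c × a ≢ c

_∈[_,_] : {A : Set} → A → A → A → Set
x ∈[ a , b ] = x ≡ a ⊎ x ≡ b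

module _ {A : Set} where

  ≢-transport : {a b x y : A} → a ≡ x → b ≡ y → x ≢ y → a ≢ b
  ≢-transport a≡x b≡y x≢y a≡b = x≢y (trans (sym a≡x) (trans a≡b b≡y))

  ∈[,]-resolveˡ : {x a b : A} → x ∈[ a , b ] → x ≢ a → x ≡ b
  ∈[,]-resolveˡ (inj₁ x≡a) x≢a = ⊥-elim (x≢a x≡a)
  ∈[,]-resolveˡ (inj₂ x≡b) _ = x≡b

  ∈[,]-resolveʳ : {x a b : A} → x ∈[ a , b ] → x ≢ b → x ≡ a
  ∈[,]-resolveʳ (inj₁ x≡a) _ = x≡a
  ∈[,]-resolveʳ (inj₂ x≡b) x≢b = ⊥-elim (x≢b x≡b)

  ∈[,]-meet : {x a b c : A} → x ∈[ a , b ] → x ∈[ a , c ] → b ≢ c → x ≡ a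
  ∈[,]-meet (inj₁ x≡a) _ _ = x≡a
  ∈[,]-meet (inj₂ x≡b) x∈[a,c] b≢c = ∈[,]-resolveʳ x∈[a,c] (λ x≡c → b≢c (trans (sym x≡b) x≡c))

  ¬Distinct3-in-pair : {a b x y z : A} → x ∈[ a , b ] → y ∈[ a , b ] → z ∈[ a , b ] → ¬ Distinct3 x y z
  ¬Distinct3-in-pair (inj₁ refl) (inj₁ refl) _ (x≢y , _) = x≢y refl
  ¬Distinct3-in-pair (inj₂ refl) (inj₂ refl) _ (x≢y , _) = x≢y refl
  ¬Distinct3-in-pair (inj₁ refl) (inj₂ refl) (inj₁ refl) (_ , _ , x≢z) = x≢z refl
  ¬Distinct3-in-pair (inj₁ refl) (inj₂ refl) (inj₂ refl) (_ , y≢z , _) = y≢z refl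
  ¬Distinct3-in-pair (inj₂ refl) (inj₁ refl) (inj₁ refl) (_ , y≢z , _) = y≢z refl
  ¬Distinct3-in-pair (inj₂ refl) (inj₁ refl) (inj₂ refl) (_ , _ , x≢z) = x≢z refl

¬Distinct3-Fin2 : {x y z : Fin 2} → ¬ Distinct3 x y z
¬Distinct3-Fin2 {x} {y} {z} = ¬Distinct3-in-pair (∈[0,1] x) (∈[0,1] y) (∈[0,1] z)
  where
  ∈[0,1] : ∀ (x : Fin 2) → x ∈[ 0F , 1F ]
  ∈[0,1] 0F = inj₁ refl
  ∈[0,1] 1F = inj₂ refl

Distinct3⇒covers : ∀ {a b c : Fin 3} → Distinct3 a b c → ∀ x → x ≡ a ⊎ x ≡ b ⊎ x ≡ c
Distinct3⇒covers {a} {b} {c} (a≢b , b≢c , a≢c) x with x ≟ a | x ≟ b | x ≟ c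
... | yes x≡a | _ | _ = inj₁ x≡a
... | no _ | yes x≡b | _ = inj₂ (inj₁ x≡b)
... | no _ | no _ | yes x≡c = inj₂ (inj₂ x≡c)
... | no x≢a | no x≢b | no x≢c =
  ⊥-elim (¬Distinct3-Fin2 ( a≢b ∘ punchOut-injective x≢a x≢b
                          , b≢c ∘ punchOut-injective x≢b x≢c
                          , a≢c ∘ punchOut-injective x≢a x≢c ))

¬surjection-Fin-suc : ∀ {m} (g : Fin m → Fin (suc m)) → ¬ (∀ x → ∃[ i ] g i ≡ x)
¬surjection-Fin-suc g onto with pigeonhole ≤-refl (proj₁ ∘ onto)
... | x , y , x<y , same-preimage =
  <⇒≢ᶠ x<y (trans (sym (proj₂ (onto x))) (trans (cong g same-preimage) (proj₂ (onto y))))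

module _ {r : ℕ} {a b c : Fin r} where

  Distinct3? : Dec (Distinct3 a b c)
  Distinct3? = ¬? (a ≟ b) ×-dec ¬? (b ≟ c) ×-dec ¬? (a ≟ c)

  ¬Distinct3⇒third : ¬ Distinct3 a b c → a ≢ b → c ∈[ a , b ]
  ¬Distinct3⇒third ¬abc a≢b with c ≟ a | c ≟ b
  ... | yes c≡a | _ = inj₁ c≡a
  ... | no _ | yes c≡b = inj₂ c≡b
  ... | no c≢a | no c≢b = ⊥-elim (¬abc (a≢b , c≢b ∘ sym , c≢a ∘ sym))

  ¬Distinct3⇒middle : ¬ Distinct3 a b c → a ≢ c → b ∈[ a , c ]
  ¬Distinct3⇒middle ¬abc a≢c with b ≟ a | b ≟ c
  ... | yes b≡a | _ = inj₁ b≡a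
  ... | no _ | yes b≡c = inj₂ b≡c
  ... | no b≢a | no b≢c = ⊥-elim (¬abc (b≢a ∘ sym , b≢c , a≢c))

module _ {r : ℕ} where

  Run : (ℕ → Fin r) → ℕ → Set
  Run x m = (∀ t → 1 ≤ t → t ≤ m → x t ≡ x 1) × Distinct3 (x 0) (x 1) (x (suc m))

  RunFree : (ℕ → Fin r) → ℕ → Set
  RunFree x N = ∀ i m → m < N → ¬ Run (x ∘ (i +_)) m

  Run-cong : ∀ {x y m} → (∀ t → x t ≡ y t) → Run x m → Run y m
  Run-cong {x} {y} x≗y (block , x0≢x1 , x1≢xm , x0≢xm) =
    (λ t 1≤t t≤m → trans (sym (x≗y t)) (trans (block t 1≤t t≤m) (x≗y 1))) ,
    transport x0≢x1 , transport x1≢xm , transport x0≢xm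
    where
    transport : ∀ {s t} → x s ≢ x t → y s ≢ y t
    transport {s} {t} = ≢-transport (sym (x≗y s)) (sym (x≗y t))

  first-change : (x : ℕ → Fin r) (L : ℕ) → x L ≢ x 0 →
                 ∃[ m ] m < L × (∀ t → t ≤ m → x t ≡ x 0) × x (suc m) ≢ x 0
  first-change x zero xL≢x0 = ⊥-elim (xL≢x0 refl)
  first-change x (suc L) xL≢x0 with x 1 ≟ x 0
  ... | no x1≢x0 = 0 , z<s , (λ { zero _ → refl }) , x1≢x0
  ... | yes x1≡x0 with first-change (x ∘ suc) L (λ e → xL≢x0 (trans e x1≡x0))
  ...   | m , m<L , constant , changes =
    suc m , s≤s m<L ,
    (λ { zero _ → refl ; (suc t) (s≤s t≤m) → trans (constant t t≤m) x1≡x0 }) ,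
    λ e → changes (trans e (sym x1≡x0))

  run-at-start : ∀ {x L} → Distinct3 (x 0) (x 1) (x (suc L)) →
                 (∀ t → t ≤ L → x (suc t) ∈[ x 1 , x (suc L) ]) → ∃[ m ] m ≤ L × Run x m
  run-at-start {x} {L} (x0≢x1 , x1≢γ , x0≢γ) tail with first-change (x ∘ suc) L (x1≢γ ∘ sym)
  ... | m , m<L , constant , changes =
    suc m , m<L ,
    (λ { (suc t) _ (s≤s t≤m) → constant t t≤m }) ,
    x0≢x1 , (changes ∘ sym) , (λ e → x0≢γ (trans e (∈[,]-resolveˡ (tail (suc m) m<L) changes)))

  private
    two-valued-step :
      ∀ {x N L} → RunFree x N → suc (suc L) ≤ N → x 0 ≢ x (suc (suc L)) →
      (x 1 ≢ x (suc (suc L)) → ∀ t → t ≤ suc L → x (suc t) ∈[ x 1 , x (suc (suc L)) ]) →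
      (x 1 ≢ x (suc L) → ∀ t → t ≤ L → x (suc t) ∈[ x 1 , x (suc L) ]) →
      (x 0 ≢ x (suc L) → ∀ t → t ≤ suc L → x t ∈[ x 0 , x (suc L) ]) →
      ∀ t → t ≤ suc L → x t ∈[ x 0 , x (suc (suc L)) ]
    two-valued-step _ _ _ _ _ _ zero _ = inj₁ refl
    two-valued-step {x} {L = L} free L≤N x0≢γ tail inner initial (suc t) (s≤s t≤L)
      with x 1 ≟ x 0 | x 1 ≟ x (suc (suc L))
    ... | yes x1≡x0 | _ =
      Sum.map₁ (λ e → trans e x1≡x0) (tail (λ e → x0≢γ (trans (sym x1≡x0) e)) t (m≤n⇒m≤1+n t≤L))
    ... | no x1≢x0 | no x1≢γ with run-at-start (x1≢x0 ∘ sym , x1≢γ , x0≢γ) (tail x1≢γ)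
    ...   | m , m≤ , run = ⊥-elim (free 0 m (<-≤-trans (s≤s m≤) L≤N) run)
    two-valued-step {x} {L = L} _ _ x0≢γ _ inner initial (suc t) (s≤s t≤L)
      | no x1≢x0 | yes x1≡γ with x (suc L) ≟ x 0
    ... | yes x'≡x0 =
      Sum.swap (Sum.map (λ e → trans e x1≡γ) (λ e → trans e x'≡x0)
        (inner (λ e → x0≢γ (trans (sym x'≡x0) (trans (sym e) x1≡γ))) t t≤L))
    ... | no x'≢x0 =
      Sum.map₂ (λ e → trans e (trans (sym x1≡x') x1≡γ)) (initial (x'≢x0 ∘ sym) (suc t) (s≤s t≤L))
      where x1≡x' = ∈[,]-resolveˡ (initial (x'≢x0 ∘ sym) 1 (s≤s z≤n)) x1≢x0

  RunFree⇒two-valued : ∀ {x N} L → RunFree x N → L ≤ N → x 0 ≢ x L →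
                       ∀ t → t ≤ L → x t ∈[ x 0 , x L ]
  RunFree⇒two-valued zero _ _ x0≢xL _ _ = ⊥-elim (x0≢xL refl)
  RunFree⇒two-valued (suc zero) _ _ _ zero _ = inj₁ refl
  RunFree⇒two-valued (suc zero) _ _ _ (suc zero) _ = inj₂ refl
  RunFree⇒two-valued (suc zero) _ _ _ (suc (suc _)) (s≤s ())
  RunFree⇒two-valued {x} (suc (suc L)) free L≤N x0≢xL t t≤ =
    Sum.[ (λ t<L → two-valued-step free L≤N x0≢xL
                     (RunFree⇒two-valued {x = x ∘ suc} (suc L) (free ∘ suc) (≤-trans (n≤1+n _) L≤N))
                     (RunFree⇒two-valued {x = x ∘ suc} L (free ∘ suc)
                        (≤-trans (n≤1+n _) (≤-trans (n≤1+n _) L≤N)))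
                     (RunFree⇒two-valued {x = x} (suc L) free (≤-trans (n≤1+n _) L≤N))
                     t (≤-pred t<L))
        , (λ { refl → inj₂ refl }) ]′
      (m≤n⇒m<n∨m≡n t≤)

even⇒double : ∀ {k} → k % 2 ≡ 0 → ∃[ h ] h + h ≡ k
even⇒double {k} even = k / 2 , (begin
  k / 2 + k / 2        ≡⟨ cong (k / 2 +_) (+-identityʳ (k / 2)) ⟨
  2 * (k / 2)          ≡⟨ *-comm 2 (k / 2) ⟩
  k / 2 * 2            ≡⟨ cong (_+ k / 2 * 2) even ⟨
  k % 2 + k / 2 * 2    ≡⟨ m≡m%n+[m/n]*n k 2 ⟨
  k                    ∎)
  where open ≡-Reasoning

odd⇒¬double : ∀ {k} t → k % 2 ≡ 1 → t + t ≢ 2 + k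
odd⇒¬double {k} t odd t+t≡2+k = even≢odd t (suc (k / 2)) (begin
  2 * t                    ≡⟨ cong (t +_) (+-identityʳ t) ⟩
  t + t                    ≡⟨ t+t≡2+k ⟩
  2 + k                    ≡⟨ cong (2 +_) (m≡m%n+[m/n]*n k 2) ⟩
  2 + (k % 2 + k / 2 * 2)  ≡⟨ cong (λ x → 2 + (x + k / 2 * 2)) odd ⟩
  3 + k / 2 * 2            ≡⟨ cong (3 +_) (*-comm (k / 2) 2) ⟩
  3 + 2 * (k / 2)          ≡⟨ cong suc (*-suc 2 (k / 2)) ⟨
  suc (2 * suc (k / 2))    ∎)
  where open ≡-Reasoning

infixr 5 _++ʷ_
_++ʷ_ : ∀ {G u v w ℓ m} → Walk G u v ℓ → Walk G v w m → Walk G u w (ℓ + m)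
here ++ʷ q = q
step a p ++ʷ q = step a (p ++ʷ q)

reverseʷ : ∀ {G} → (∀ {u v} → Adj G u v → Adj G v u) →
           ∀ {u v ℓ} → Walk G u v ℓ → Walk G v u ℓ
reverseʷ adj-sym here = here
reverseʷ {G} adj-sym (step {ℓ = ℓ} a p) =
  subst (Walk G _ _) (+-comm ℓ 1) (reverseʷ adj-sym p ++ʷ step (adj-sym a) here)

record IsDistance (G : Graph) (d : V G → V G → ℕ) : Set where
  field
    walk   : ∀ u v → Walk G u v (d u v)
    d-self : ∀ u → d u u ≡ 0
    d-step : ∀ {u u'} v → Adj G u u' → d u v ≤ suc (d u' v)

  ≤-length : ∀ {u v ℓ} → Walk G u v ℓ → d u v ≤ ℓ
  ≤-length {u} here = ≤-reflexive (d-self u)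
  ≤-length {v = v} (step a p) = ≤-trans (d-step v a) (s≤s (≤-length p))

  dist : ∀ u v → Dist G u v (d u v)
  dist u v = walk u v , λ _ → ≤-length

  Dist⇒≡ : ∀ {u v m} → Dist G u v m → m ≡ d u v
  Dist⇒≡ {u} {v} (p , shortest) = ≤-antisym (shortest _ (walk u v)) (≤-length p)

  d≡0⇒≡ : ∀ {u v} → d u v ≡ 0 → u ≡ v
  d≡0⇒≡ {u} {v} d≡0 with d u v | walk u v
  d≡0⇒≡ refl | .0 | here = refl

  d-sym : (∀ {u v} → Adj G u v → Adj G v u) → ∀ u v → d u v ≡ d v u
  d-sym adj-sym u v = ≤-antisym (≤-length (reverseʷ adj-sym (walk v u))) (≤-length (reverseʷ adj-sym (walk u v)))

NoRainbow : {A : Set} {r : ℕ} → (A → A → ℕ) → (A → Fin r) → Set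
NoRainbow d c = ∀ x y z → d x y ≡ d y z → ¬ Distinct3 (c x) (c y) (c z)

module _ (G : Graph) where
  open Inverse (enum G)

  any-vertex? : {P : V G → Set} → (∀ v → Dec (P v)) → Dec (∃ P)
  any-vertex? {P} P? with any? (P? ∘ from)
  ... | yes (i , p) = yes (from i , p)
  ... | no ¬p = no λ (v , p) → ¬p (to v , subst P (sym (strictlyInverseʳ v)) p)

  rainbow-or-none : ∀ {d r} → IsDistance G d → (c : V G → Fin r) → HasRainbow3AP G c ⊎ NoRainbow d c
  rainbow-or-none {d} isDist c
    with any-vertex? (λ x → any-vertex? λ y → any-vertex? λ z → (d x y ≟ℕ d y z) ×-dec Distinct3?)
  ... | yes (x , y , z , e , rainbow) =
    inj₁ (x , y , z , d x y , dist x y , subst (Dist G y z) (sym e) (dist y z) , rainbow)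
    where open IsDistance isDist
  ... | no none = inj₂ λ x y z e rainbow → none (x , y , z , e , rainbow)

Exact⇒Distinct3 : ∀ {G r} {c : V G → Fin (3 + r)} → Exact G (3 + r) c →
                  ∃[ u ] ∃[ v ] ∃[ w ] Distinct3 (c u) (c v) (c w)
Exact⇒Distinct3 exact =
  proj₁ (exact 0F) , proj₁ (exact 1F) , proj₁ (exact 2F) ,
  ≢-transport (proj₂ (exact 0F)) (proj₂ (exact 1F)) (λ ()) ,
  ≢-transport (proj₂ (exact 1F)) (proj₂ (exact 2F)) (λ ()) ,
  ≢-transport (proj₂ (exact 0F)) (proj₂ (exact 2F)) (λ ())

NoRainbow⇒¬AllRainbow : ∀ {G d r} → IsDistance G d → (c : V G → Fin r) → Exact G r c → NoRainbow d c →
                        ¬ AllRainbow G r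
NoRainbow⇒¬AllRainbow isDist c exact free all with all c exact
... | x , y , z , _ , dxy , dyz , rainbow = free x y z (trans (sym (Dist⇒≡ dxy)) (Dist⇒≡ dyz)) rainbow
  where open IsDistance isDist

_⊞_ : {A B : Set} → (A → A → ℕ) → (B → B → ℕ) → A × B → A × B → ℕ
(dA ⊞ dB) (x , y) (x' , y') = dA x x' + dB y y'

module _ {G H : Graph} where

  mapʷˡ : ∀ {x x' ℓ} y → Walk G x x' ℓ → Walk (G □ H) (x , y) (x' , y) ℓ
  mapʷˡ y here = here
  mapʷˡ y (step a p) = step (inj₂ (refl , a)) (mapʷˡ y p)

  mapʷʳ : ∀ x {y y' ℓ} → Walk H y y' ℓ → Walk (G □ H) (x , y) (x , y') ℓ
  mapʷʳ x here = here
  mapʷʳ x (step a p) = step (inj₁ (refl , a)) (mapʷʳ x p)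

  □-isDistance : ∀ {dG dH} → IsDistance G dG → IsDistance H dH → IsDistance (G □ H) (dG ⊞ dH)
  □-isDistance {dG} {dH} isG isH = record
    { walk   = λ { (x , y) (x' , y') → mapʷˡ y (G.walk x x') ++ʷ mapʷʳ x' (H.walk y y') }
    ; d-self = λ { (x , y) → cong₂ _+_ (G.d-self x) (H.d-self y) }
    ; d-step = d-step
    }
    where
    module G = IsDistance isG
    module H = IsDistance isH
    d-step : ∀ {u u'} v → Adj (G □ H) u u' → (dG ⊞ dH) u v ≤ suc ((dG ⊞ dH) u' v)
    d-step {x , y} {_ , y'} (v , w) (inj₁ (refl , a)) =
      ≤-trans (+-monoʳ-≤ (dG x v) (H.d-step w a)) (≤-reflexive (+-suc (dG x v) (dH y' w)))
    d-step {x , y} {x' , _} (v , w) (inj₂ (refl , a)) = +-monoˡ-≤ (dH y w) (G.d-step v a)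

pathDist : ∀ {m} → Fin m → Fin m → ℕ
pathDist i j = ∣ toℕ i - toℕ j ∣

module _ {m : ℕ} where

  private
    ascend : ∀ (i j : Fin m) t → toℕ i + t ≡ toℕ j → Walk (P m) i j t
    ascend i j zero e = subst (λ j → Walk (P m) i j 0) (toℕ-injective (trans (sym (+-identityʳ (toℕ i))) e)) here
    ascend i j (suc t) e =
      step (inj₁ (sym (toℕ-fromℕ< i+1<m)))
           (ascend (fromℕ< i+1<m) j t (trans (cong (_+ t) (toℕ-fromℕ< i+1<m)) (trans (sym (+-suc _ t)) e)))
      where
      i+1<m : suc (toℕ i) < m
      i+1<m = ≤-<-trans (≤-trans (s≤s (m≤m+n (toℕ i) t)) (≤-reflexive (trans (sym (+-suc _ t)) e)))
                        (toℕ<n j)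

    adjacent⇒∣-∣≡1 : ∀ {a b} → suc a ≡ b ⊎ suc b ≡ a → ∣ a - b ∣ ≡ 1
    adjacent⇒∣-∣≡1 {a} (inj₁ refl) = trans (cong (∣ a -_∣) (+-comm 1 a)) (∣m-m+n∣≡n a 1)
    adjacent⇒∣-∣≡1 {b = b} (inj₂ refl) =
      trans (∣-∣-comm (suc b) b) (trans (cong (∣ b -_∣) (+-comm 1 b)) (∣m-m+n∣≡n b 1))

  path-isDistance : IsDistance (P m) pathDist
  path-isDistance = record
    { walk   = walk
    ; d-self = λ i → ∣n-n∣≡0 (toℕ i)
    ; d-step = λ {i} {i'} j a → begin
        ∣ toℕ i - toℕ j ∣                     ≤⟨ ∣-∣-triangle (toℕ i) (toℕ i') (toℕ j) ⟩
        ∣ toℕ i - toℕ i' ∣ + ∣ toℕ i' - toℕ j ∣ ≡⟨ cong (_+ ∣ toℕ i' - toℕ j ∣) (adjacent⇒∣-∣≡1 a) ⟩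
        suc ∣ toℕ i' - toℕ j ∣                ∎
    }
    where
    open ≤-Reasoning
    walk : ∀ i j → Walk (P m) i j (pathDist i j)
    walk i j with ≤-total (toℕ i) (toℕ j)
    ... | inj₁ i≤j = subst (Walk (P m) i j) (sym (m≤n⇒∣m-n∣≡n∸m i≤j))
                       (ascend i j (toℕ j ∸ toℕ i) (m+[n∸m]≡n i≤j))
    ... | inj₂ j≤i = subst (Walk (P m) i j)
                       (trans (sym (m≤n⇒∣m-n∣≡n∸m j≤i)) (∣-∣-comm (toℕ j) (toℕ i)))
                       (reverseʷ Sum.swap (ascend j i (toℕ i ∸ toℕ j) (m+[n∸m]≡n j≤i)))

module Cycle (n : ℕ) {{n≢0 : NonZero n}} where

  infixl 6 _⊕_
  _⊕_ : Fin n → ℕ → Fin n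
  i ⊕ t = fromℕ< (m%n<n (toℕ i + t) n)

  toℕ-⊕ : ∀ i t → toℕ (i ⊕ t) ≡ (toℕ i + t) % n
  toℕ-⊕ i t = toℕ-fromℕ< (m%n<n (toℕ i + t) n)

  private
    [m%n+t]%n≡[m+t]%n : ∀ m t → (m % n + t) % n ≡ (m + t) % n
    [m%n+t]%n≡[m+t]%n m t = begin
      (m % n + t) % n           ≡⟨ %-distribˡ-+ (m % n) t n ⟩
      (m % n % n + t % n) % n   ≡⟨ cong (λ z → (z + t % n) % n) (m%n%n≡m%n m n) ⟩
      (m % n + t % n) % n       ≡⟨ %-distribˡ-+ m t n ⟨
      (m + t) % n               ∎
      where open ≡-Reasoning

  ⊕-assoc : ∀ i s t → i ⊕ s ⊕ t ≡ i ⊕ (s + t)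
  ⊕-assoc i s t = toℕ-injective (begin
    toℕ (i ⊕ s ⊕ t)         ≡⟨ toℕ-⊕ (i ⊕ s) t ⟩
    (toℕ (i ⊕ s) + t) % n   ≡⟨ cong (λ z → (z + t) % n) (toℕ-⊕ i s) ⟩
    ((toℕ i + s) % n + t) % n ≡⟨ [m%n+t]%n≡[m+t]%n (toℕ i + s) t ⟩
    (toℕ i + s + t) % n     ≡⟨ cong (_% n) (+-assoc (toℕ i) s t) ⟩
    (toℕ i + (s + t)) % n   ≡⟨ toℕ-⊕ i (s + t) ⟨
    toℕ (i ⊕ (s + t))       ∎)
    where open ≡-Reasoning

  ⊕-identityʳ : ∀ i → i ⊕ 0 ≡ i
  ⊕-identityʳ i = toℕ-injective
    (trans (toℕ-⊕ i 0) (trans (cong (_% n) (+-identityʳ (toℕ i))) (m<n⇒m%n≡m (toℕ<n i))))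

  ⊕-+n : ∀ i t → i ⊕ (t + n) ≡ i ⊕ t
  ⊕-+n i t = toℕ-injective (begin
    toℕ (i ⊕ (t + n))     ≡⟨ toℕ-⊕ i (t + n) ⟩
    (toℕ i + (t + n)) % n ≡⟨ cong (_% n) (+-assoc (toℕ i) t n) ⟨
    (toℕ i + t + n) % n   ≡⟨ [m+n]%n≡m%n (toℕ i + t) n ⟩
    (toℕ i + t) % n       ≡⟨ toℕ-⊕ i t ⟨
    toℕ (i ⊕ t)           ∎)
    where open ≡-Reasoning

  ⊕-comm : ∀ i s t → i ⊕ s ⊕ t ≡ i ⊕ t ⊕ s
  ⊕-comm i s t = trans (⊕-assoc i s t) (trans (cong (i ⊕_) (+-comm s t)) (sym (⊕-assoc i t s)))

  ⊕-n : ∀ i → i ⊕ n ≡ i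
  ⊕-n i = trans (⊕-+n i 0) (⊕-identityʳ i)

  ⊕-∸ : ∀ i s → s ≤ n → i ⊕ s ⊕ (n ∸ s) ≡ i
  ⊕-∸ i s s≤n = trans (⊕-assoc i s (n ∸ s)) (trans (cong (i ⊕_) (m+[n∸m]≡n s≤n)) (⊕-n i))

  offset : Fin n → Fin n → ℕ
  offset i j = (toℕ j + (n ∸ toℕ i)) % n

  offset<n : ∀ i j → offset i j < n
  offset<n i j = m%n<n _ n

  private
    i+[t+[n∸i]]≡t+n : ∀ i t → i ≤ n → i + (t + (n ∸ i)) ≡ t + n
    i+[t+[n∸i]]≡t+n i t i≤n = begin
      i + (t + (n ∸ i)) ≡⟨ cong (i +_) (+-comm t (n ∸ i)) ⟩
      i + ((n ∸ i) + t) ≡⟨ +-assoc i (n ∸ i) t ⟨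
      i + (n ∸ i) + t   ≡⟨ cong (_+ t) (m+[n∸m]≡n i≤n) ⟩
      n + t             ≡⟨ +-comm n t ⟩
      t + n             ∎
      where open ≡-Reasoning

  ⊕-offset : ∀ i j → i ⊕ offset i j ≡ j
  ⊕-offset i j = toℕ-injective (begin
    toℕ (i ⊕ offset i j)                      ≡⟨ toℕ-⊕ i (offset i j) ⟩
    (toℕ i + (toℕ j + (n ∸ toℕ i)) % n) % n   ≡⟨ cong (_% n) (+-comm (toℕ i) _) ⟩
    ((toℕ j + (n ∸ toℕ i)) % n + toℕ i) % n   ≡⟨ [m%n+t]%n≡[m+t]%n _ (toℕ i) ⟩
    (toℕ j + (n ∸ toℕ i) + toℕ i) % n         ≡⟨ cong (_% n) (+-comm _ (toℕ i)) ⟩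
    (toℕ i + (toℕ j + (n ∸ toℕ i))) % n       ≡⟨ cong (_% n) (i+[t+[n∸i]]≡t+n (toℕ i) (toℕ j) (<⇒≤ (toℕ<n i))) ⟩
    (toℕ j + n) % n                           ≡⟨ [m+n]%n≡m%n (toℕ j) n ⟩
    toℕ j % n                                 ≡⟨ m<n⇒m%n≡m (toℕ<n j) ⟩
    toℕ j                                     ∎)
    where open ≡-Reasoning

  offset-⊕ : ∀ i s → s < n → offset i (i ⊕ s) ≡ s
  offset-⊕ i s s<n = begin
    (toℕ (i ⊕ s) + (n ∸ toℕ i)) % n     ≡⟨ cong (λ z → (z + (n ∸ toℕ i)) % n) (toℕ-⊕ i s) ⟩
    ((toℕ i + s) % n + (n ∸ toℕ i)) % n ≡⟨ [m%n+t]%n≡[m+t]%n (toℕ i + s) _ ⟩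
    (toℕ i + s + (n ∸ toℕ i)) % n       ≡⟨ cong (_% n) (+-assoc (toℕ i) s _) ⟩
    (toℕ i + (s + (n ∸ toℕ i))) % n     ≡⟨ cong (_% n) (i+[t+[n∸i]]≡t+n (toℕ i) s (<⇒≤ (toℕ<n i))) ⟩
    (s + n) % n                         ≡⟨ [m+n]%n≡m%n s n ⟩
    s % n                               ≡⟨ m<n⇒m%n≡m s<n ⟩
    s                                   ∎
    where open ≡-Reasoning

  arc : ℕ → ℕ
  arc s = s ⊓ (n ∸ s)

  cycDist : Fin n → Fin n → ℕ
  cycDist i j = arc (offset i j)

  cycDist-⊕ : ∀ i s → s < n → cycDist i (i ⊕ s) ≡ arc s
  cycDist-⊕ i s s<n = cong arc (offset-⊕ i s s<n)

  cycDist-self : ∀ i → cycDist i i ≡ 0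
  cycDist-self i = subst (λ j → cycDist i j ≡ 0) (⊕-identityʳ i) (cycDist-⊕ i 0 n>0)
    where n>0 = >-nonZero⁻¹ n

  CycAdj⇒≡⊕1 : ∀ {i j} → CycAdj n i j → j ≡ i ⊕ 1
  CycAdj⇒≡⊕1 {i} {j} (inj₁ i+1≡j) = toℕ-injective (sym (begin
    toℕ (i ⊕ 1)      ≡⟨ toℕ-⊕ i 1 ⟩
    (toℕ i + 1) % n  ≡⟨ cong (_% n) (trans (+-comm (toℕ i) 1) i+1≡j) ⟩
    toℕ j % n        ≡⟨ m<n⇒m%n≡m (toℕ<n j) ⟩
    toℕ j            ∎))
    where open ≡-Reasoning
  CycAdj⇒≡⊕1 {i} {j} (inj₂ (i+1≡n , j≡0)) = toℕ-injective (trans j≡0 (sym (begin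
    toℕ (i ⊕ 1)      ≡⟨ toℕ-⊕ i 1 ⟩
    (toℕ i + 1) % n  ≡⟨ cong (_% n) (trans (+-comm (toℕ i) 1) i+1≡n) ⟩
    n % n            ≡⟨ n%n≡0 n ⟩
    0                ∎)))
    where open ≡-Reasoning

  CycAdj-⊕1 : ∀ i → CycAdj n i (i ⊕ 1)
  CycAdj-⊕1 i with suc (toℕ i) <? n
  ... | yes i+1<n = inj₁ (sym (trans (toℕ-⊕ i 1) (trans (cong (_% n) (+-comm (toℕ i) 1)) (m<n⇒m%n≡m i+1<n))))
  ... | no  i+1≮n =
    inj₂ (i+1≡n , trans (toℕ-⊕ i 1) (trans (cong (_% n) (trans (+-comm (toℕ i) 1) i+1≡n)) (n%n≡0 n)))
    where i+1≡n = ≤-antisym (toℕ<n i) (≮⇒≥ i+1≮n)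

  arc-suc-≤ : ∀ s → arc (suc s) ≤ suc (arc s)
  arc-suc-≤ s = ⊓-mono-≤ (≤-refl {suc s}) (≤-trans (∸-monoʳ-≤ n (n≤1+n s)) (n≤1+n _))

  arc-≤-suc : ∀ s → suc s ≤ n → arc s ≤ suc (arc (suc s))
  arc-≤-suc s s<n = ⊓-mono-≤ (≤-trans (n≤1+n s) (n≤1+n _)) (≤-reflexive (+-∸-assoc 1 s<n))

  cycDist-⊕1 : ∀ i j → cycDist i j ≤ suc (cycDist (i ⊕ 1) j) × cycDist (i ⊕ 1) j ≤ suc (cycDist i j)
  cycDist-⊕1 i j = subst Lipschitz (⊕-offset i j) (lipschitz⊕ (offset i j) (offset<n i j))
    where
    Lipschitz : Fin n → Set
    Lipschitz j = cycDist i j ≤ suc (cycDist (i ⊕ 1) j) × cycDist (i ⊕ 1) j ≤ suc (cycDist i j)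
    lipschitz⊕ : ∀ s → s < n → Lipschitz (i ⊕ s)
    lipschitz⊕ zero _ = subst Lipschitz (sym (⊕-identityʳ i))
      ( ≤-trans (≤-reflexive (cycDist-self i)) z≤n
      , subst (λ d → cycDist (i ⊕ 1) i ≤ suc d) (sym (cycDist-self i)) back≤1 )
      where
      n>0 = >-nonZero⁻¹ n
      back≤1 : cycDist (i ⊕ 1) i ≤ 1
      back≤1 = begin
        cycDist (i ⊕ 1) i                     ≡⟨ cong (cycDist (i ⊕ 1)) (⊕-∸ i 1 n>0) ⟨
        cycDist (i ⊕ 1) (i ⊕ 1 ⊕ (n ∸ 1))     ≡⟨ cycDist-⊕ (i ⊕ 1) (n ∸ 1) (∸-monoʳ-< z<s n>0) ⟩
        (n ∸ 1) ⊓ (n ∸ (n ∸ 1))               ≤⟨ m⊓n≤n (n ∸ 1) _ ⟩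
        n ∸ (n ∸ 1)                           ≡⟨ m∸[m∸n]≡n n>0 ⟩
        1                                     ∎
        where open ≤-Reasoning
    lipschitz⊕ (suc s) s<n = subst Lipschitz (⊕-assoc i 1 s)
      (subst₂ (λ a b → a ≤ suc b × b ≤ suc a) (sym outer) (sym inner)
         (arc-suc-≤ s , arc-≤-suc s (<⇒≤ s<n)))
      where
      inner : cycDist (i ⊕ 1) (i ⊕ 1 ⊕ s) ≡ arc s
      inner = cycDist-⊕ (i ⊕ 1) s (<-trans (n<1+n s) s<n)
      outer : cycDist i (i ⊕ 1 ⊕ s) ≡ arc (suc s)
      outer = trans (cong (cycDist i) (⊕-assoc i 1 s)) (cycDist-⊕ i (suc s) s<n)

  forward : ∀ i t → Walk (C n) i (i ⊕ t) t
  forward i zero = subst (λ j → Walk (C n) i j 0) (sym (⊕-identityʳ i)) here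
  forward i (suc t) =
    step (inj₁ (CycAdj-⊕1 i)) (subst (λ j → Walk (C n) (i ⊕ 1) j t) (⊕-assoc i 1 t) (forward (i ⊕ 1) t))

  cycle-isDistance : IsDistance (C n) cycDist
  cycle-isDistance = record
    { walk   = λ i j → subst (λ z → Walk (C n) i z (cycDist i j)) (⊕-offset i j) (walk⊕ i (offset i j) (offset<n i j))
    ; d-self = cycDist-self
    ; d-step = d-step
    }
    where
    walk⊕ : ∀ i s → s < n → Walk (C n) i (i ⊕ s) (arc s)
    walk⊕ i s s<n with ≤-total s (n ∸ s)
    ... | inj₁ s≤n∸s = subst (Walk (C n) i _) (sym (m≤n⇒m⊓n≡m s≤n∸s)) (forward i s)
    ... | inj₂ n∸s≤s = subst (Walk (C n) i _) (sym (m≥n⇒m⊓n≡n n∸s≤s))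
        (reverseʷ Sum.swap
          (subst (λ j → Walk (C n) (i ⊕ s) j (n ∸ s)) (⊕-∸ i s (<⇒≤ s<n)) (forward (i ⊕ s) (n ∸ s))))
    d-step : ∀ {i i'} j → Adj (C n) i i' → cycDist i j ≤ suc (cycDist i' j)
    d-step {i} j (inj₁ a) =
      subst (λ i' → cycDist i j ≤ suc (cycDist i' j)) (sym (CycAdj⇒≡⊕1 a)) (proj₁ (cycDist-⊕1 i j))
    d-step {i' = i'} j (inj₂ a) =
      subst (λ i → cycDist i j ≤ suc (cycDist i' j)) (sym (CycAdj⇒≡⊕1 a)) (proj₂ (cycDist-⊕1 i' j))

  cycDist-sym : ∀ i j → cycDist i j ≡ cycDist j i
  cycDist-sym = IsDistance.d-sym cycle-isDistance Sum.swap

-- Cylinder κ studies P₃ □ C₂ₖ for k = 2 + κ, so that k ≥ 2 holds by computation.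
module Cylinder (κ : ℕ) where

  k : ℕ
  k = 2 + κ

  n : ℕ
  n = 2 * k

  open Cycle n public

  n≡k+k : n ≡ k + k
  n≡k+k = cong (k +_) (+-identityʳ k)

  n∸k≡k : n ∸ k ≡ k
  n∸k≡k = trans (cong (_∸ k) n≡k+k) (m+n∸m≡n k k)

  k<n : k < n
  k<n = subst (k <_) (sym n≡k+k) (m<m+n k z<s)

  arc-≤k : ∀ {s} → s ≤ k → arc s ≡ s
  arc-≤k {s} s≤k = m≤n⇒m⊓n≡m (≤-trans s≤k (subst (_≤ n ∸ s) n∸k≡k (∸-monoʳ-≤ n s≤k)))

  arc≤k : ∀ s → arc s ≤ k
  arc≤k s with ≤-total s k
  ... | inj₁ s≤k = ≤-trans (m⊓n≤m s (n ∸ s)) s≤k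
  ... | inj₂ k≤s = ≤-trans (m⊓n≤n s (n ∸ s)) (subst (n ∸ s ≤_) n∸k≡k (∸-monoʳ-≤ n k≤s))

  cycDist≤k : ∀ i j → cycDist i j ≤ k
  cycDist≤k i j = arc≤k (offset i j)

  cycDist-⊕ʳ : ∀ i {t} → t ≤ k → cycDist i (i ⊕ t) ≡ t
  cycDist-⊕ʳ i t≤k = trans (cycDist-⊕ i _ (≤-<-trans t≤k k<n)) (arc-≤k t≤k)

  cycDist-⊕ˡ : ∀ i {t} → t ≤ k → cycDist (i ⊕ t) i ≡ t
  cycDist-⊕ˡ i {t} t≤k = trans (cycDist-sym (i ⊕ t) i) (cycDist-⊕ʳ i t≤k)

  cycDist-⊕-⊕ : ∀ i {a b d} → a + d ≡ b → d ≤ k → cycDist (i ⊕ a) (i ⊕ b) ≡ d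
  cycDist-⊕-⊕ i {a} {d = d} refl d≤k =
    trans (cong (cycDist (i ⊕ a)) (sym (⊕-assoc i a d))) (cycDist-⊕ʳ (i ⊕ a) d≤k)

  cycDist-⊕-⊕ˡ : ∀ i {a b d} → a + d ≡ b → d ≤ k → cycDist (i ⊕ b) (i ⊕ a) ≡ d
  cycDist-⊕-⊕ˡ i {a} {b} e d≤k = trans (cycDist-sym (i ⊕ b) (i ⊕ a)) (cycDist-⊕-⊕ i e d≤k)

  cycDist-wrap : ∀ i {a d} → a + d ≡ n → d ≤ k → cycDist i (i ⊕ a) ≡ d
  cycDist-wrap i {a} {d} e d≤k = trans (cong (λ j → cycDist j (i ⊕ a)) (sym i⊕a⊕d≡i)) (cycDist-⊕ˡ (i ⊕ a) d≤k)
    where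
    i⊕a⊕d≡i : i ⊕ a ⊕ d ≡ i
    i⊕a⊕d≡i = trans (⊕-assoc i a d) (trans (cong (i ⊕_) e) (⊕-n i))

  antipode-involutive : ∀ i → i ⊕ k ⊕ k ≡ i
  antipode-involutive i = trans (⊕-assoc i k k) (trans (cong (i ⊕_) (sym n≡k+k)) (⊕-n i))

  cycDist≡k⇒antipode : ∀ i j → cycDist i j ≡ k → j ≡ i ⊕ k
  cycDist≡k⇒antipode i j d≡k = trans (sym (⊕-offset i j)) (cong (i ⊕_) (arc≡k⇒≡k (offset<n i j) d≡k))
    where
    arc≡k⇒≡k : ∀ {s} → s < n → arc s ≡ k → s ≡ k
    arc≡k⇒≡k {s} s<n arc≡k with ≤-total s k
    ... | inj₁ s≤k = trans (sym (arc-≤k s≤k)) arc≡k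
    ... | inj₂ k≤s = begin
      s               ≡⟨ m∸[m∸n]≡n (<⇒≤ s<n) ⟨
      n ∸ (n ∸ s)     ≡⟨ cong (n ∸_) (trans (sym (m≥n⇒m⊓n≡n n∸s≤s)) arc≡k) ⟩
      n ∸ k           ≡⟨ n∸k≡k ⟩
      k               ∎
      where
      open ≡-Reasoning
      n∸s≤s : n ∸ s ≤ s
      n∸s≤s = ≤-trans (subst (n ∸ s ≤_) n∸k≡k (∸-monoʳ-≤ n k≤s)) k≤s

  halves : ∀ i j → ∃[ t ] t ≤ k × (j ≡ i ⊕ t ⊎ j ≡ i ⊕ k ⊕ t)
  halves i j with ≤-total (offset i j) k
  ... | inj₁ s≤k = offset i j , s≤k , inj₁ (sym (⊕-offset i j))
  ... | inj₂ k≤s = offset i j ∸ k , s∸k≤k ,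
      inj₂ (sym (trans (⊕-assoc i k _) (trans (cong (i ⊕_) (m+[n∸m]≡n k≤s)) (⊕-offset i j))))
    where
    s∸k≤k : offset i j ∸ k ≤ k
    s∸k≤k = subst (offset i j ∸ k ≤_) n∸k≡k (∸-monoˡ-≤ k (<⇒≤ (offset<n i j)))

  cycDist-via-antipode : ∀ i j → cycDist i j + cycDist j (i ⊕ k) ≡ k
  cycDist-via-antipode i j with halves i j
  ... | t , t≤k , inj₁ refl = begin
    cycDist i (i ⊕ t) + cycDist (i ⊕ t) (i ⊕ k)
      ≡⟨ cong₂ _+_ (cycDist-⊕ʳ i t≤k) (cycDist-⊕-⊕ i (m+[n∸m]≡n t≤k) (m∸n≤m k t)) ⟩
    t + (k ∸ t)                                 ≡⟨ m+[n∸m]≡n t≤k ⟩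
    k                                           ∎
    where open ≡-Reasoning
  ... | t , t≤k , inj₂ refl = begin
    cycDist i (i ⊕ k ⊕ t) + cycDist (i ⊕ k ⊕ t) (i ⊕ k) ≡⟨ cong₂ _+_ far (cycDist-⊕ˡ (i ⊕ k) t≤k) ⟩
    (k ∸ t) + t                                         ≡⟨ m∸n+n≡m t≤k ⟩
    k                                                   ∎
    where
    open ≡-Reasoning
    far : cycDist i (i ⊕ k ⊕ t) ≡ k ∸ t
    far = trans (cong (cycDist i) (⊕-assoc i k t))
                (cycDist-wrap i (trans (+-assoc k t (k ∸ t)) (trans (cong (k +_) (m+[n∸m]≡n t≤k)) (sym n≡k+k)))
                                (m∸n≤m k t))

  Vertex : Set
  Vertex = Fin 3 × Fin n

  δ : Vertex → Vertex → ℕ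
  δ = pathDist ⊞ cycDist

  δ-isDistance : IsDistance (P 3 □ C n) δ
  δ-isDistance = □-isDistance path-isDistance cycle-isDistance

  δ-sym : ∀ u v → δ u v ≡ δ v u
  δ-sym (a , i) (b , j) = cong₂ _+_ (∣-∣-comm (toℕ a) (toℕ b)) (cycDist-sym i j)

  mirror : Vertex → Vertex
  mirror (a , i) = opposite a , i

  mirror-involutive : ∀ v → mirror (mirror v) ≡ v
  mirror-involutive (a , i) = cong (_, i) (opposite-involutive a)

  δ-mirror : ∀ u v → δ (mirror u) (mirror v) ≡ δ u v
  δ-mirror (a , i) (b , j) = cong (_+ cycDist i j) (pathDist-opposite a b)
    where
    pathDist-opposite : ∀ a b → pathDist (opposite a) (opposite b) ≡ pathDist {3} a b
    pathDist-opposite 0F 0F = refl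
    pathDist-opposite 0F 1F = refl
    pathDist-opposite 0F 2F = refl
    pathDist-opposite 1F 0F = refl
    pathDist-opposite 1F 1F = refl
    pathDist-opposite 1F 2F = refl
    pathDist-opposite 2F 0F = refl
    pathDist-opposite 2F 1F = refl
    pathDist-opposite 2F 2F = refl

  near-or-antipode : ∀ i w → δ (0F , i) w ≤ suc k ⊎ w ≡ (2F , i ⊕ k)
  near-or-antipode i (0F , j) = inj₁ (≤-trans (cycDist≤k i j) (n≤1+n k))
  near-or-antipode i (1F , j) = inj₁ (s≤s (cycDist≤k i j))
  near-or-antipode i (2F , j) with cycDist i j ≟ℕ k
  ... | yes d≡k = inj₂ (cong (2F ,_) (cycDist≡k⇒antipode i j d≡k))
  ... | no  d≢k = inj₁ (s≤s (≤∧≢⇒< (cycDist≤k i j) d≢k))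

  module NoRainbowColouring {r} (c : Vertex → Fin r) (free : NoRainbow δ c) where

    forced : ∀ {x y z} → δ x y ≡ δ y z → c x ≢ c y → c z ∈[ c x , c y ]
    forced {x} {y} {z} e = ¬Distinct3⇒third (free x y z e)

    forced-middle : ∀ {x y z} → δ x y ≡ δ y z → c x ≢ c z → c y ∈[ c x , c z ]
    forced-middle {x} {y} {z} e = ¬Distinct3⇒middle (free x y z e)

    middle : Fin n → Fin r
    middle i = c (1F , i)

    no-short-run : ∀ p q → q < k → ¬ Run (λ t → middle (p ⊕ t)) q
    no-short-run p zero _ (_ , _ , x1≢x1 , _) = x1≢x1 refl
    no-short-run p (suc zero) _ (_ , rainbow) =
      free (1F , p ⊕ 0) (1F , p ⊕ 1) (1F , p ⊕ 2)
        (trans (cycDist-⊕-⊕ p refl 1≤k) (sym (cycDist-⊕-⊕ p refl 1≤k))) rainbow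
      where 1≤k = s≤s z≤n
    -- Above the last β of a longer block the top row is forced to γ, above the first β to α;
    -- together with a β below they form a rainbow 3-AP.
    no-short-run p M@(suc (suc q)) M<k (block , α≢β , β≢γ , α≢γ) =
      free (0F , p ⊕ M) (0F , p ⊕ 1) (1F , p ⊕ suc q)
        (trans (cycDist-⊕-⊕ˡ p refl (≤-trans (n≤1+n _) M≤k))
               (cong suc (sym (cycDist-⊕-⊕ p refl (≤-trans (n≤1+n _) (≤-trans (n≤1+n _) M≤k))))))
        ( ≢-transport top-M≡γ top-1≡α (α≢γ ∘ sym)
        , ≢-transport top-1≡α β≡x α≢β
        , ≢-transport top-M≡γ β≡x (β≢γ ∘ sym) )
      where
      M≤k = <⇒≤ M<k
      β≡x = block (suc q) (s≤s z≤n) (n≤1+n _)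
      βM≡x = block M (s≤s z≤n) ≤-refl
      top-M≡γ : c (0F , p ⊕ M) ≡ middle (p ⊕ suc M)
      top-M≡γ = ∈[,]-meet
        (forced {1F , p ⊕ suc M} {1F , p ⊕ M} {0F , p ⊕ M}
           (trans (cycDist-⊕-⊕ˡ p (+-comm M 1) (s≤s z≤n)) (cong suc (sym (cycDist-self (p ⊕ M)))))
           (λ e → β≢γ (trans (sym βM≡x) (sym e))))
        (forced {1F , p ⊕ suc M} {1F , p ⊕ 0} {0F , p ⊕ M}
           (trans (cycDist-⊕-⊕ˡ p refl M<k) (cong suc (sym (cycDist-⊕-⊕ p refl M≤k))))
           (α≢γ ∘ sym))
        (λ e → α≢β (trans (sym e) βM≡x))
      top-1≡α : c (0F , p ⊕ 1) ≡ middle (p ⊕ 0)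
      top-1≡α = ∈[,]-meet
        (forced {1F , p ⊕ 0} {1F , p ⊕ 1} {0F , p ⊕ 1}
           (trans (cycDist-⊕-⊕ p refl (s≤s z≤n)) (cong suc (sym (cycDist-self (p ⊕ 1)))))
           α≢β)
        (forced {1F , p ⊕ 0} {1F , p ⊕ suc M} {0F , p ⊕ 1}
           (trans (cycDist-⊕-⊕ p refl M<k) (cong suc (sym (cycDist-⊕-⊕ˡ p refl M≤k))))
           α≢γ)
        β≢γ

    window-two-valued : ∀ p L → L ≤ k → middle p ≢ middle (p ⊕ L) →
                        ∀ t → t ≤ L → middle (p ⊕ t) ∈[ middle p , middle (p ⊕ L) ]
    window-two-valued p L L≤k ends-differ t t≤L =
      subst (λ z → middle (p ⊕ t) ∈[ z , middle (p ⊕ L) ]) (cong middle (⊕-identityʳ p))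
        (RunFree⇒two-valued {x = λ t → middle (p ⊕ t)} L run-free L≤k
           (λ e → ends-differ (trans (cong middle (sym (⊕-identityʳ p))) e)) t t≤L)
      where
      run-free : RunFree (λ t → middle (p ⊕ t)) k
      run-free i q q<k run = no-short-run (p ⊕ i) q q<k (Run-cong (λ t → cong middle (sym (⊕-assoc p i t))) run)

    two-valued-around : ∀ b → middle (b ⊕ k) ≢ middle b → ∀ j → middle j ∈[ middle b , middle (b ⊕ k) ]
    two-valued-around b b'≢b j with halves b j
    ... | t , t≤k , inj₁ refl = window-two-valued b k ≤-refl (b'≢b ∘ sym) t t≤k
    ... | t , t≤k , inj₂ refl =
      Sum.swap (subst (λ z → middle (b ⊕ k ⊕ t) ∈[ middle (b ⊕ k) , middle z ]) (antipode-involutive b)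
        (window-two-valued (b ⊕ k) k ≤-refl (λ e → b'≢b (trans e (cong middle (antipode-involutive b)))) t t≤k))

    periodic-representative : ∀ i j → middle (j ⊕ k) ≡ middle j → ∃[ t ] t ≤ k × middle (i ⊕ t) ≡ middle j
    periodic-representative i j periodic with halves i j
    ... | t , t≤k , inj₁ refl = t , t≤k , refl
    ... | t , t≤k , inj₂ refl = t , t≤k , trans (cong middle (sym j⊕k≡i⊕t)) periodic
      where
      j⊕k≡i⊕t : i ⊕ k ⊕ t ⊕ k ≡ i ⊕ t
      j⊕k≡i⊕t = trans (⊕-comm (i ⊕ k) t k) (cong (_⊕ t) (antipode-involutive i))

    ¬rainbow-around : ∀ b x y → middle (b ⊕ k) ≢ middle b →
                         middle b ≢ middle x → middle b ≢ middle y → middle x ≢ middle y → ⊥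
    ¬rainbow-around b x y b'≢b b≢x b≢y x≢y
      with two-valued-around b b'≢b x | two-valued-around b b'≢b y
    ... | inj₁ e | _ = b≢x (sym e)
    ... | inj₂ _ | inj₁ e = b≢y (sym e)
    ... | inj₂ e | inj₂ e' = x≢y (trans e (sym e'))

    -- Either some vertex differs from its antipode, and the two windows of length k starting
    -- there are two-valued, or the middle row is k-periodic and all colours occur in one window.
    middle-not-rainbow : ∀ i j l → ¬ Distinct3 (middle i) (middle j) (middle l)
    middle-not-rainbow i j l (i≢j , j≢l , i≢l)
      with middle (i ⊕ k) ≟ middle i | middle (j ⊕ k) ≟ middle j | middle (l ⊕ k) ≟ middle l
    ... | no i'≢i | _ | _ = ¬rainbow-around i j l i'≢i i≢j i≢l j≢l
    ... | yes _ | no j'≢j | _ = ¬rainbow-around j i l j'≢j (i≢j ∘ sym) j≢l i≢l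
    ... | yes _ | yes _ | no l'≢l = ¬rainbow-around l i j l'≢l (i≢l ∘ sym) (j≢l ∘ sym) i≢j
    ... | yes _ | yes j-periodic | yes l-periodic
      with periodic-representative i j j-periodic | periodic-representative i l l-periodic
    ...   | t , t≤k , t~j | u , u≤k , u~l with ≤-total t u
    ...     | inj₁ t≤u = Sum.[ i≢j ∘ sym , j≢l ]′
                (subst₂ (λ x y → x ∈[ middle i , y ]) t~j u~l
                   (window-two-valued i u u≤k (λ e → i≢l (trans e u~l)) t t≤u))
    ...     | inj₂ u≤t = Sum.[ i≢l ∘ sym , j≢l ∘ sym ]′
                (subst₂ (λ x y → x ∈[ middle i , y ]) u~l t~j
                   (window-two-valued i t t≤k (λ e → i≢j (trans e t~j)) u u≤t))

    middle-two-valued : ∀ l l' → middle l ≢ middle l' → ∀ j → middle j ∈[ middle l , middle l' ]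
    middle-two-valued l l' l≢l' j = ¬Distinct3⇒third (middle-not-rainbow l l' j) l≢l'

    -- q = j ⊕ (n ∸ 1) is the left neighbour of j.
    fresh-top⇒uniform-off-antipode : ∀ j → (∀ l → middle l ≢ c (0F , j)) →
                                     ∀ l → cycDist j l < k → middle l ≡ middle (j ⊕ (n ∸ 1))
    fresh-top⇒uniform-off-antipode j fresh l d<k = trans
      (∈[,]-resolveʳ (forced {1F , j ⊕ cycDist j l} {0F , j} {1F , l}
                        (cong suc (cycDist-⊕ˡ j (<⇒≤ d<k))) (fresh (j ⊕ cycDist j l)))
                     (fresh l))
      (near (cycDist j l) d<k)
      where
      q = j ⊕ (n ∸ 1)
      q⊕1+s≡j⊕s : ∀ s → q ⊕ suc s ≡ j ⊕ s
      q⊕1+s≡j⊕s s =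
        trans (⊕-assoc j (n ∸ 1) (suc s)) (trans (cong (j ⊕_) (trans (+-suc (n ∸ 1) s) (+-comm n s))) (⊕-+n j s))
      near : ∀ s → s < k → middle (j ⊕ s) ≡ middle q
      near s s<k = ∈[,]-resolveˡ
        (forced-middle {0F , j} {1F , j ⊕ s} {1F , q}
           (trans (cong suc (cycDist-⊕ʳ j (<⇒≤ s<k)))
                  (sym (trans (cong (λ i → cycDist i q) (sym (q⊕1+s≡j⊕s s))) (cycDist-⊕ˡ q s<k))))
           (fresh q ∘ sym))
        (fresh (j ⊕ s))

    -- Otherwise the middle row is a away from the antipode j ⊕ k and some b ≠ a at it; the bottom
    -- vertex next to the antipode is then forced into [b , γ], [a , γ] and [a , b] at once.
    fresh-top⇒monochromatic-middle : ∀ j → (∀ l → middle l ≢ c (0F , j)) → ∀ l l' → middle l ≡ middle l'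
    fresh-top⇒monochromatic-middle j fresh l l' with middle l ≟ middle l'
    ... | yes l≡l' = l≡l'
    ... | no l≢l' =
      ⊥-elim (Sum.[ (λ e → fresh (j ⊕ (n ∸ 1)) (trans (sym e) x≡γ)) , (λ e → b≢γ (trans (sym e) x≡γ)) ]′ x∈[a,b])
      where
      γ = c (0F , j)
      a = middle (j ⊕ (n ∸ 1))
      b = middle (j ⊕ k)
      x = c (2F , j ⊕ suc k)

      uniform = fresh-top⇒uniform-off-antipode j fresh

      a≢b : a ≢ b
      a≢b a≡b = l≢l' (trans (everywhere l) (sym (everywhere l')))
        where
        everywhere : ∀ l → middle l ≡ a
        everywhere l with cycDist j l ≟ℕ k
        ... | yes d≡k = trans (cong middle (cycDist≡k⇒antipode j l d≡k)) (sym a≡b)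
        ... | no  d≢k = uniform l (≤∧≢⇒< (cycDist≤k j l) d≢k)

      b≢γ : b ≢ γ
      b≢γ = fresh (j ⊕ k)

      bottom≡γ : c (2F , j) ≡ γ
      bottom≡γ = ∈[,]-meet
        (forced {0F , j} {1F , j ⊕ k} {2F , j} (cong suc (cycDist-sym j (j ⊕ k))) (b≢γ ∘ sym))
        (forced {0F , j} {1F , j} {2F , j} refl (fresh j ∘ sym))
        (λ e → a≢b (trans (sym (uniform j (subst (_< k) (sym (cycDist-self j)) z<s))) (sym e)))

      beyond-dist : cycDist j (j ⊕ suc k) ≡ suc κ
      beyond-dist = cycDist-wrap j (trans (sym (+-suc k (suc κ))) (sym n≡k+k)) (n≤1+n _)

      κ<k : κ < k
      κ<k = n≤1+n (suc κ)

      j⊕κ≡a : middle (j ⊕ κ) ≡ a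
      j⊕κ≡a = uniform (j ⊕ κ) (subst (_< k) (sym (cycDist-⊕ʳ j (<⇒≤ κ<k))) κ<k)

      x∈[b,γ] : x ∈[ b , γ ]
      x∈[b,γ] = forced {1F , j ⊕ k} {0F , j} {2F , j ⊕ suc k}
        (cong suc (trans (cycDist-⊕ˡ j ≤-refl) (sym (cong suc beyond-dist)))) b≢γ

      x∈[a,γ] : x ∈[ a , γ ]
      x∈[a,γ] = Sum.map (λ e → trans e j⊕κ≡a) (λ e → trans e bottom≡γ)
        (forced {1F , j ⊕ κ} {2F , j} {2F , j ⊕ suc k}
          (trans (cong suc (cycDist-⊕ˡ j (<⇒≤ κ<k))) (sym beyond-dist))
          (λ e → fresh (j ⊕ κ) (trans e bottom≡γ)))

      x∈[a,b] : x ∈[ a , b ]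
      x∈[a,b] = Sum.map₁ (λ e → trans e j⊕κ≡a)
        (forced {1F , j ⊕ κ} {1F , j ⊕ k} {2F , j ⊕ suc k}
          (trans (cycDist-⊕-⊕ j (+-comm κ 2) (s≤s (s≤s z≤n)))
                 (cong suc (sym (cycDist-⊕-⊕ j (+-comm k 1) (s≤s z≤n)))))
          (λ e → a≢b (trans (sym j⊕κ≡a) e)))

      x≡γ : x ≡ γ
      x≡γ = ∈[,]-meet (Sum.swap x∈[a,γ]) (Sum.swap x∈[b,γ]) a≢b

    top-colour-in-middle : ∀ l l' → middle l ≢ middle l' → ∀ j → c (0F , j) ∈[ middle l , middle l' ]
    top-colour-in-middle l l' l≢l' j with c (0F , j) ≟ middle l | c (0F , j) ≟ middle l'
    ... | yes e | _ = inj₁ e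
    ... | no _ | yes e = inj₂ e
    ... | no γ≢l | no γ≢l' = ⊥-elim (l≢l' (fresh-top⇒monochromatic-middle j fresh l l'))
      where
      fresh : ∀ m → middle m ≢ c (0F , j)
      fresh m e = Sum.[ (λ e' → γ≢l (trans (sym e) e')) , (λ e' → γ≢l' (trans (sym e) e')) ]′
                    (middle-two-valued l l' l≢l' m)

    colour-near-top : ∀ {a} j → (∀ l → middle l ≡ a) → c (0F , j) ≢ a →
                      ∀ w → δ (0F , j) w ≤ suc k → c w ∈[ c (0F , j) , a ]
    colour-near-top j constant R≢a w d≤ with δ (0F , j) w in d≡
    ... | zero = inj₁ (cong c (sym (IsDistance.d≡0⇒≡ δ-isDistance d≡)))
    ... | suc t = Sum.swap (Sum.map₁ (λ e → trans e (constant (j ⊕ t)))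
        (forced {1F , j ⊕ t} {0F , j} {w} (trans (cong suc (cycDist-⊕ˡ j (≤-pred d≤))) (sym d≡))
           (λ e → R≢a (trans (sym e) (constant (j ⊕ t))))))

  G : Graph
  G = P 3 □ C n

  NoRainbow-mirror : ∀ {r} {c : Vertex → Fin r} → NoRainbow δ c → NoRainbow δ (c ∘ mirror)
  NoRainbow-mirror free x y z e =
    free (mirror x) (mirror y) (mirror z) (trans (δ-mirror x y) (trans e (sym (δ-mirror y z))))

  Exact-mirror : ∀ {r} {c : Vertex → Fin r} → Exact G r c → Exact G r (c ∘ mirror)
  Exact-mirror {c = c} exact x =
    mirror (proj₁ (exact x)) , trans (cong c (mirror-involutive (proj₁ (exact x)))) (proj₂ (exact x))

  colour-in-middle-pair : ∀ {r} (c : Vertex → Fin r) → NoRainbow δ c → ∀ l l' → c (1F , l) ≢ c (1F , l') →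
                          ∀ v → c v ∈[ c (1F , l) , c (1F , l') ]
  colour-in-middle-pair c free l l' l≢l' (0F , j) = NoRainbowColouring.top-colour-in-middle c free l l' l≢l' j
  colour-in-middle-pair c free l l' l≢l' (1F , j) = NoRainbowColouring.middle-two-valued c free l l' l≢l' j
  colour-in-middle-pair c free l l' l≢l' (2F , j) =
    NoRainbowColouring.top-colour-in-middle (c ∘ mirror) (NoRainbow-mirror free) l l' l≢l' j

  record Normal {r} (c : Vertex → Fin r) : Set where
    field
      free     : NoRainbow δ c
      a        : Fin r
      constant : ∀ l → c (1F , l) ≡ a
      j        : Fin n
      top≢a    : c (0F , j) ≢ a

  normalise : ∀ {r} {c : Vertex → Fin r} {u v w} → Exact G r c → NoRainbow δ c →
              Distinct3 (c u) (c v) (c w) → ∃[ c' ] Exact G r c' × Normal c'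
  normalise {r} {c} {u} {v} {w} exact free rainbow@(u≢v , _) = off-middle (proj₁ off) (proj₂ off)
    where
    a = c (1F , proj₂ u)

    constant : ∀ l → c (1F , l) ≡ a
    constant l with c (1F , l) ≟ a
    ... | yes l≡a = l≡a
    ... | no  l≢a = ⊥-elim (¬Distinct3-in-pair (pair u) (pair v) (pair w) rainbow)
      where pair = colour-in-middle-pair c free l (proj₂ u) l≢a

    off : ∃[ x ] c x ≢ a
    off with c u ≟ a
    ... | no  u≢a = u , u≢a
    ... | yes u≡a = v , λ v≡a → u≢v (trans u≡a (sym v≡a))

    off-middle : ∀ x → c x ≢ a → ∃[ c' ] Exact G r c' × Normal c'
    off-middle (0F , j) top≢a =
      c , exact , record { free = free ; a = a ; constant = constant ; j = j ; top≢a = top≢a }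
    off-middle (1F , j) middle≢a = ⊥-elim (middle≢a (constant j))
    off-middle (2F , j) bottom≢a =
      c ∘ mirror , Exact-mirror exact ,
      record { free = NoRainbow-mirror free ; a = a ; constant = constant ; j = j ; top≢a = bottom≢a }

  module Normalised {r} {c : Vertex → Fin r} (N : Normal c) where
    open Normal N public

    R = c (0F , j)
    B = c (2F , j ⊕ k)

    colour-classes : ∀ w → c w ∈[ R , a ] ⊎ c w ≡ B
    colour-classes w with near-or-antipode j w
    ... | inj₁ d≤ = inj₁ (NoRainbowColouring.colour-near-top c free j constant top≢a w d≤)
    ... | inj₂ refl = inj₂ refl

  ¬Normal-4 : {c : Vertex → Fin 4} → Exact G 4 c → ¬ Normal c
  ¬Normal-4 exact N = ¬surjection-Fin-suc colours covered
    where
    open Normalised N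
    colours : Fin 3 → Fin 4
    colours 0F = R
    colours 1F = a
    colours 2F = B
    covered : ∀ x → ∃[ i ] colours i ≡ x
    covered x with colour-classes (proj₁ (exact x))
    ... | inj₁ (inj₁ e) = 0F , trans (sym e) (proj₂ (exact x))
    ... | inj₁ (inj₂ e) = 1F , trans (sym e) (proj₂ (exact x))
    ... | inj₂ e        = 2F , trans (sym e) (proj₂ (exact x))

  ¬Normal-3 : ∀ {c : Vertex → Fin 3} h → h + h ≡ k → Exact G 3 c → ¬ Normal c
  ¬Normal-3 zero () _ _
  ¬Normal-3 {c} (suc h') h+h≡k exact N =
    free (0F , j) g (2F , j ⊕ k) (trans δ-left (sym δ-right)) (R≢g , g≢B , R≢B)
    where
    open Normalised N

    B∉[R,a] : ¬ (B ∈[ R , a ])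
    B∉[R,a] B∈ = ¬surjection-Fin-suc colours covered
      where
      colours : Fin 2 → Fin 3
      colours 0F = R
      colours 1F = a
      covered : ∀ x → ∃[ i ] colours i ≡ x
      covered x with colour-classes (proj₁ (exact x))
      ... | inj₁ (inj₁ e) = 0F , trans (sym e) (proj₂ (exact x))
      ... | inj₁ (inj₂ e) = 1F , trans (sym e) (proj₂ (exact x))
      ... | inj₂ e = Sum.[ (λ B≡R → 0F , trans (sym B≡R) (trans (sym e) (proj₂ (exact x))))
                         , (λ B≡a → 1F , trans (sym B≡a) (trans (sym e) (proj₂ (exact x)))) ]′ B∈

    h = suc h'
    g = (0F , j ⊕ suc h)

    1+h+[h-1]≡k : suc h + h' ≡ k
    1+h+[h-1]≡k = trans (cong suc (sym (+-suc h' h'))) h+h≡k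

    1+h≤k : suc h ≤ k
    1+h≤k = subst (suc h ≤_) h+h≡k (s≤s (m≤n+m h h'))

    h-1≤k : h' ≤ k
    h-1≤k = ≤-trans (n≤1+n h') (≤-trans (n≤1+n h) 1+h≤k)

    δ-left : δ (0F , j) g ≡ suc h
    δ-left = cycDist-⊕ʳ j 1+h≤k

    δ-right : δ g (2F , j ⊕ k) ≡ suc h
    δ-right = cong (suc ∘ suc) (cycDist-⊕-⊕ j 1+h+[h-1]≡k h-1≤k)

    g∈[R,a] : c g ∈[ R , a ]
    g∈[R,a] = NoRainbowColouring.colour-near-top c free j constant top≢a g
      (≤-trans (≤-reflexive δ-left) (≤-trans 1+h≤k (n≤1+n k)))

    g∈[B,a] : c g ∈[ B , a ]
    g∈[B,a] = NoRainbowColouring.colour-near-top (c ∘ mirror) (NoRainbow-mirror free) (j ⊕ k) constant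
      (B∉[R,a] ∘ inj₂) (2F , j ⊕ suc h)
      (≤-trans (≤-reflexive (cong (suc ∘ suc) (cycDist-⊕-⊕ˡ j 1+h+[h-1]≡k h-1≤k)))
               (≤-trans 1+h≤k (n≤1+n k)))

    R≢B : R ≢ B
    R≢B R≡B = B∉[R,a] (inj₁ (sym R≡B))

    g≡a : c g ≡ a
    g≡a = ∈[,]-meet (Sum.swap g∈[R,a]) (Sum.swap g∈[B,a]) R≢B

    R≢g : R ≢ c g
    R≢g R≡g = top≢a (trans R≡g g≡a)

    g≢B : c g ≢ B
    g≢B g≡B = B∉[R,a] (inj₂ (trans (sym g≡B) g≡a))

  ¬Normal⇒AllRainbow : ∀ {r} → (∀ {c : Vertex → Fin (3 + r)} → Exact G (3 + r) c → ¬ Normal c) →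
                          AllRainbow G (3 + r)
  ¬Normal⇒AllRainbow {r} no-normal c exact = Sum.[ id , contradiction ]′ (rainbow-or-none G δ-isDistance c)
    where
    contradiction : NoRainbow δ c → HasRainbow3AP G c
    contradiction free with Exact⇒Distinct3 {G} exact
    ... | _ , _ , _ , distinct with normalise exact free distinct
    ...   | _ , exact' , normal = ⊥-elim (no-normal exact' normal)

  ¬AllRainbow-1 : ¬ AllRainbow G 1
  ¬AllRainbow-1 = NoRainbow⇒¬AllRainbow δ-isDistance (λ _ → 0F) (λ { 0F → (0F , 0F) , refl ; (fsuc ()) })
    (λ _ _ _ _ (c₁≢c₂ , _) → c₁≢c₂ refl)

  ¬AllRainbow-2 : ¬ AllRainbow G 2
  ¬AllRainbow-2 = NoRainbow⇒¬AllRainbow δ-isDistance top-or-not exact (λ _ _ _ _ → ¬Distinct3-Fin2)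
    where
    top-or-not : Vertex → Fin 2
    top-or-not (0F , _) = 0F
    top-or-not (1F , _) = 1F
    top-or-not (2F , _) = 1F
    exact : Exact G 2 top-or-not
    exact 0F = (0F , 0F) , refl
    exact 1F = (1F , 0F) , refl

  module Antipodal where

    X₀ X₁ : Vertex
    X₀ = 0F , 0F
    X₁ = 2F , 0F ⊕ k

    _≟ᵥ_ : (u v : Vertex) → Dec (u ≡ v)
    _≟ᵥ_ = ≡-dec _≟_ _≟_

    colour : Vertex → Fin 3
    colour v with v ≟ᵥ X₀ | v ≟ᵥ X₁
    ... | yes _ | _     = 0F
    ... | no _  | yes _ = 1F
    ... | no _  | no _  = 2F

    colour⁻¹-0F : ∀ v → colour v ≡ 0F → v ≡ X₀
    colour⁻¹-0F v _ with v ≟ᵥ X₀ | v ≟ᵥ X₁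
    colour⁻¹-0F v _  | yes v≡X₀ | _ = v≡X₀
    colour⁻¹-0F v () | no _ | yes _
    colour⁻¹-0F v () | no _ | no _

    colour⁻¹-1F : ∀ v → colour v ≡ 1F → v ≡ X₁
    colour⁻¹-1F v _ with v ≟ᵥ X₀ | v ≟ᵥ X₁
    colour⁻¹-1F v () | yes _ | _
    colour⁻¹-1F v _  | no _ | yes v≡X₁ = v≡X₁
    colour⁻¹-1F v () | no _ | no _

    exact : Exact G 3 colour
    exact 0F = X₀ , refl
    exact 1F = X₁ , colour-X₁
      where
      colour-X₁ : colour X₁ ≡ 1F
      colour-X₁ with X₁ ≟ᵥ X₀ | X₁ ≟ᵥ X₁
      ... | yes () | _
      ... | no _ | yes _ = refl
      ... | no _ | no X₁≢X₁ = ⊥-elim (X₁≢X₁ refl)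
    exact 2F = (1F , 0F) , refl

    δ-X₀X₁ : δ X₀ X₁ ≡ 2 + k
    δ-X₀X₁ = cong (suc ∘ suc) (cycDist-⊕ʳ 0F ≤-refl)

    far-from-X₀ : ∀ w → δ X₀ w ≡ 2 + k → w ≡ X₁
    far-from-X₀ w d≡ = Sum.[ (λ d≤ → ⊥-elim (1+n≰n (subst (_≤ suc k) d≡ d≤))) , id ]′ (near-or-antipode 0F w)

    far-from-X₁ : ∀ w → δ X₁ w ≡ 2 + k → w ≡ X₀
    far-from-X₁ w d≡ =
      trans (sym (mirror-involutive w)) (trans (cong mirror mirror-w≡) (cong (0F ,_) (antipode-involutive 0F)))
      where
      mirror-w≡ : mirror w ≡ (2F , 0F ⊕ k ⊕ k)
      mirror-w≡ = Sum.[ (λ d≤ → ⊥-elim (1+n≰n (subst (_≤ suc k) (trans (δ-mirror X₁ w) d≡) d≤))) , id ]′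
                    (near-or-antipode (0F ⊕ k) (mirror w))

    δ-through : ∀ w → δ X₀ w + δ w X₁ ≡ 2 + k
    δ-through (b , l) = begin
      (pathDist 0F b + cycDist 0F l) + (pathDist b 2F + cycDist l (0F ⊕ k))
        ≡⟨ interchange +-commutativeSemigroup (pathDist 0F b) (cycDist 0F l) (pathDist b 2F) (cycDist l (0F ⊕ k)) ⟩
      (pathDist 0F b + pathDist b 2F) + (cycDist 0F l + cycDist l (0F ⊕ k))
        ≡⟨ cong₂ _+_ (rows b) (cycDist-via-antipode 0F l) ⟩
      2 + k
        ∎
      where
      open ≡-Reasoning
      rows : ∀ b → pathDist 0F b + pathDist b 2F ≡ 2
      rows 0F = refl
      rows 1F = refl
      rows 2F = refl

    ¬equidistant : k % 2 ≡ 1 → ∀ {w} → δ X₀ w ≢ δ w X₁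
    ¬equidistant odd {w} e = odd⇒¬double (δ X₀ w) odd (trans (cong (δ X₀ w +_) e) (δ-through w))

    δ-X₁X₀ : δ X₁ X₀ ≡ 2 + k
    δ-X₁X₀ = trans (δ-sym X₁ X₀) δ-X₀X₁

    colour-preimage : ∀ {x X} → (∀ v → colour v ≡ x → v ≡ X) →
                      ∀ {v₁ v₂ v₃} → Distinct3 (colour v₁) (colour v₂) (colour v₃) → v₁ ≡ X ⊎ v₂ ≡ X ⊎ v₃ ≡ X
    colour-preimage {x} colour⁻¹ {v₁} {v₂} {v₃} rainbow =
      Sum.map (colour⁻¹ v₁ ∘ sym) (Sum.map (colour⁻¹ v₂ ∘ sym) (colour⁻¹ v₃ ∘ sym)) (Distinct3⇒covers rainbow x)

    no-rainbow : k % 2 ≡ 1 → NoRainbow δ colour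
    no-rainbow odd v₁ v₂ v₃ e rainbow@(_ , _ , c₁≢c₃)
      with colour-preimage colour⁻¹-0F rainbow | colour-preimage colour⁻¹-1F rainbow
    ... | inj₁ refl        | inj₁ ()
    ... | inj₁ refl        | inj₂ (inj₁ refl) = c₁≢c₃ (cong colour (sym (far-from-X₁ v₃ (trans (sym e) δ-X₀X₁))))
    ... | inj₁ refl        | inj₂ (inj₂ refl) = ¬equidistant odd {v₂} e
    ... | inj₂ (inj₁ refl) | inj₁ refl        = c₁≢c₃ (cong colour (sym (far-from-X₀ v₃ (trans (sym e) δ-X₁X₀))))
    ... | inj₂ (inj₁ refl) | inj₂ (inj₁ ())
    ... | inj₂ (inj₁ refl) | inj₂ (inj₂ refl) = c₁≢c₃ (cong colour (far-from-X₀ v₁ (trans (δ-sym X₀ v₁) (trans e δ-X₀X₁))))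
    ... | inj₂ (inj₂ refl) | inj₁ refl        = ¬equidistant odd {v₂} (trans (δ-sym X₀ v₂) (trans (sym e) (δ-sym X₁ v₂)))
    ... | inj₂ (inj₂ refl) | inj₂ (inj₁ refl) = c₁≢c₃ (cong colour (far-from-X₁ v₁ (trans (δ-sym X₁ v₁) (trans e δ-X₁X₀))))
    ... | inj₂ (inj₂ refl) | inj₂ (inj₂ ())

  4≤order : 4 ≤ order G
  4≤order = ≤-trans (*-monoʳ-≤ 2 (s≤s (s≤s (z≤n {κ})))) (m≤n*m n 3)

  ¬AllRainbow-below-3 : ∀ r → 1 ≤ r → r < 3 → ¬ AllRainbow G r
  ¬AllRainbow-below-3 1 _ _ = ¬AllRainbow-1
  ¬AllRainbow-below-3 2 _ _ = ¬AllRainbow-2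
  ¬AllRainbow-below-3 (suc (suc (suc _))) _ (s≤s (s≤s (s≤s ())))

  aw-even : k % 2 ≡ 0 → IsAW3 G 3
  aw-even even with even⇒double even
  ... | h , h+h≡k =
    inj₁ (s≤s z≤n , ≤-trans (n≤1+n 3) 4≤order , ¬Normal⇒AllRainbow (¬Normal-3 h h+h≡k) , ¬AllRainbow-below-3)

  aw-odd : k % 2 ≡ 1 → IsAW3 G 4
  aw-odd odd = inj₁ (s≤s z≤n , 4≤order , ¬Normal⇒AllRainbow ¬Normal-4 , ¬AllRainbow-below-4)
    where
    ¬AllRainbow-below-4 : ∀ r → 1 ≤ r → r < 4 → ¬ AllRainbow G r
    ¬AllRainbow-below-4 1 _ _ = ¬AllRainbow-1
    ¬AllRainbow-below-4 2 _ _ = ¬AllRainbow-2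
    ¬AllRainbow-below-4 3 _ _ = NoRainbow⇒¬AllRainbow δ-isDistance colour exact (no-rainbow odd)
      where open Antipodal
    ¬AllRainbow-below-4 (suc (suc (suc (suc _)))) _ (s≤s (s≤s (s≤s (s≤s ()))))

lemma9 : (k : ℕ) → 2 ≤ k →
    (k % 2 ≡ 0 → IsAW3 (P 3 □ C (2 * k)) 3) × (k % 2 ≡ 1 → IsAW3 (P 3 □ C (2 * k)) 4)
lemma9 (suc (suc κ)) (s≤s (s≤s z≤n)) = aw-even , aw-odd
  where open Cylinder κ
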